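{- For any two finite unlabelled pointed tree-shaped Kripke models $(\mathfrak{M},w)$ and $(\mathfrak{N},v)$, there is a homomorphism from $(\mathfrak{M},w)$ to $(\mathfrak{N},v)$ or a homomorphism from $(\mathfrak{N},v)$ to $(\mathfrak{M},w)$.
   Context: A Kripke model is $\mathfrak{M}=(W,R,V)$ with $W$ non-empty finite, $R\subseteq W\times W$, $V$ assigning subsets of $W$ to propositional symbols; it is unlabelled if $V(p)=\emptyset$ for every propositional symbol $p$. A pointed model $(\mathfrak{M},w)$ is tree-shaped if every world has a unique directed $R$-path from $w$. A homomorphism from $(\mathfrak{M},w)$ to $(\mathfrak{N},v)$, $\mathfrak{N}=(W',R',V')$, is a map $f:W\to W'$ with $f(w)=v$ such that $uRz$ implies $f(u)R'f(z)$ and $u\in V(p)$ implies $f(u)\in V'(p)$. -}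

module Defs where

open import Data.Nat using (ℕ)
open import Data.Fin using (Fin)
open import Data.List using (List; []; _∷_)
open import Data.Product using (Σ; ∃; _×_; _,_)
open import Relation.Binary.PropositionalEquality using (_≡_)
open import Relation.Nullary using (¬_)

PropSym : Set
PropSym = ℕ

-- A Kripke model with a finite non-empty set of worlds W = Fin (suc n')
-- (non-emptiness is given by the number of worlds being a successor).
record KripkeModel : Set₁ where
  field
    size-1 : ℕ
    R      : Fin (Data.Nat.suc size-1) → Fin (Data.Nat.suc size-1) → Set
    V      : PropSym → Fin (Data.Nat.suc size-1) → Set

  World : Set
  World = Fin (Data.Nat.suc size-1)

open KripkeModel public

Unlabelled : KripkeModel → Set
Unlabelled M = ∀ (p : PropSym) (u : World M) → ¬ V M p u

-- A directed R-path from u to z whose sequence of worlds is  u ∷ xs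
-- (xs lists the worlds after u; the last one is z, or xs = [] and u = z).
data Path {W : Set} (R : W → W → Set) : W → List W → W → Set where
  here  : ∀ {u} → Path R u [] u
  step  : ∀ {u x xs z} → R u x → Path R x xs z → Path R u (x ∷ xs) z

TreeShaped : (M : KripkeModel) → World M → Set
TreeShaped M w =
  ∀ (u : World M) →
    (∃ λ xs → Path (R M) w xs u) ×
    (∀ xs ys → Path (R M) w xs u → Path (R M) w ys u → xs ≡ ys)

record Hom (M : KripkeModel) (w : World M) (N : KripkeModel) (v : World N) : Set where
  field
    f       : World M → World N
    root    : f w ≡ v
    pres-R  : ∀ {u z} → R M u z → R N (f u) (f z)
    pres-V  : ∀ {p u} → V M p u → V N p (f u)

{-# OPTIONS --safe #-}
module Submission where

-- In a tree-shaped model every edge goes from depth k to depth k + 1, where the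
-- depth of a world is the length of its unique path from the root.  Hence, when
-- there is no valuation to respect, sending each world of (M , w) of depth k to
-- the k-th world of a longest branch of (N , v) is a homomorphism, provided M is
-- no deeper than that branch; and of any two models one is no deeper than the other.

open import Defs
open import Data.Nat using (ℕ; zero; suc; _≤_; _<_; s≤s)
open import Data.Nat.Properties using (≤-refl; ≤-trans; ≤-total)
open import Data.List using (List; [_]; _∷ʳ_; length; allFin)
open import Data.List.Properties using (length-++-comm)
open import Data.List.Extrema.Nat using (argmax; v≤f[argmax]⁺)
open import Data.List.Membership.Propositional.Properties using (∈-allFin)
open import Data.List.Relation.Unary.Any as Any using ()
open import Data.Product using (∃; _,_; proj₁; proj₂)
open import Data.Sum using (_⊎_; inj₁; inj₂)
open import Data.Empty using (⊥-elim)
open import Relation.Binary.PropositionalEquality using (_≡_; refl; trans; cong; subst)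

module _ {W : Set} {R : W → W → Set} where

  _▷_ : ∀ {u xs z y} → Path R u xs z → R z y → Path R u (xs ∷ʳ y) y
  here       ▷ r = step r here
  step r′ p ▷ r = step r′ (p ▷ r)

  -- Indices beyond the end of the path return its last world.
  vertex : ∀ {u xs z} → Path R u xs z → ℕ → W
  vertex {u = u} p          zero    = u
  vertex {u = u} here       (suc k) = u
  vertex         (step _ p) (suc k) = vertex p k

  vertex-edge : ∀ {u xs z} (p : Path R u xs z) {k} → k < length xs →
                R (vertex p k) (vertex p (suc k))
  vertex-edge (step r p) {zero}  _         = r
  vertex-edge (step r p) {suc k} (s≤s k<n) = vertex-edge p k<n

module Depth (M : KripkeModel) (w : World M) (T : TreeShaped M w) where

  branch : World M → List (World M)
  branch u = proj₁ (proj₁ (T u))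

  pathFromRoot : (u : World M) → Path (R M) w (branch u) u
  pathFromRoot u = proj₂ (proj₁ (T u))

  depth : World M → ℕ
  depth u = length (branch u)

  depth-path : ∀ {xs u} → Path (R M) w xs u → depth u ≡ length xs
  depth-path {u = u} p = cong length (proj₂ (T u) _ _ (pathFromRoot u) p)

  depth-root : depth w ≡ 0
  depth-root = depth-path here

  depth-edge : ∀ {u z} → R M u z → depth z ≡ suc (depth u)
  depth-edge {u} r = trans (depth-path (pathFromRoot u ▷ r))
                           (length-++-comm (branch u) [ _ ])

  deepest : ∃ λ b → ∀ u → depth u ≤ depth b
  deepest = argmax depth w (allFin _) , below-argmax
    where
    below-argmax : ∀ u → depth u ≤ depth (argmax depth w (allFin _))
    below-argmax u =
      v≤f[argmax]⁺ {f = depth} w (allFin _) (inj₂ (Any.map (λ { refl → ≤-refl }) (∈-allFin u)))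

open Depth

homAlongPath : ∀ {M w N v ys b} → Unlabelled M → (T : TreeShaped M w) →
               (p : Path (R N) v ys b) → (∀ u → depth M w T u ≤ length ys) →
               Hom M w N v
homAlongPath {M} {w} {N} unlabelled T p shallow = record
  { f      = λ u → vertex p (depth M w T u)
  ; root   = cong (vertex p) (depth-root M w T)
  ; pres-R = edge
  ; pres-V = λ {q} {u} x → ⊥-elim (unlabelled q u x)
  }
  where
  edge : ∀ {u z} → R M u z → R N (vertex p (depth M w T u)) (vertex p (depth M w T z))
  edge {u} {z} r rewrite depth-edge M w T r =
    vertex-edge p (subst (_≤ _) (depth-edge M w T r) (shallow z))

proposition3p5 : (M : KripkeModel) (w : World M) (N : KripkeModel) (v : World N) →
    Unlabelled M → Unlabelled N → TreeShaped M w → TreeShaped N v →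
    Hom M w N v ⊎ Hom N v M w
proposition3p5 M w N v UM UN TM TN with deepest M w TM | deepest N v TN
... | a , a-deepest | b , b-deepest with ≤-total (depth M w TM a) (depth N v TN b)
... | inj₁ a≤b = inj₁ (homAlongPath UM TM (pathFromRoot N v TN b) λ u → ≤-trans (a-deepest u) a≤b)
... | inj₂ b≤a = inj₂ (homAlongPath UN TN (pathFromRoot M w TM a) λ u → ≤-trans (b-deepest u) b≤a)
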